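{- Let $X$ be a finite set with $n\ge1$ elements, let $\mathcal{F}$ be a union-closed family of subsets of $X$ with $\bigcup_{f\in\mathcal{F}}f=X$, let $g\in\mathcal{F}$ and $\eta\in\max(\mathrm{Fib}(g))$. Then for every word $u=b_1\cdots b_n$ listing the elements of $X$ which has a prefix containing $\eta\setminus\eta^*$, we have $\varphi_u(g)=\eta$.
   Context: Union-closed: $f,g\in\mathcal{F}\Rightarrow f\cup g\in\mathcal{F}$. $\min(\mathcal{F})^{\uparrow}=\{z\subseteq X:\exists h\in\min(\mathcal{F}),\ h\subseteq z\}$, where $\min(\mathcal{F})$ is the set of inclusion-minimal members. For $z\in\min(\mathcal{F})^{\uparrow}$, $z^*=\bigcup_{\{h\in\mathcal{F}:h\subseteq z\}}h$, and $\mathrm{Fib}(g)=\{z\in\min(\mathcal{F})^{\uparrow}:z^*=g\}$, with $\max(\mathrm{Fib}(g))$ its inclusion-maximal elements. A set $\gamma\subseteq X$ is contained in a prefix of $u=b_1\cdots b_n$ if either $\gamma=\emptyset$ or $\gamma=\{b_1,\dots,b_l\}$ for some $1\le l\le n$. Rising functions: for $T\subseteq 2^X$ and $a\in X$, $\varphi_{T,a}(z)=z\cup\{a\}$ if $z\cup\{a\}\notin T$, and $z$ otherwise; with $\varphi_0=\mathrm{id}$, $\mathcal{F}_0=\mathcal{F}$, $\varphi_j=\varphi_{\mathcal{F}_{j-1},b_j}\circ\varphi_{j-1}$, $\mathcal{F}_j=\varphi_j(\mathcal{F})$, set $\varphi_u=\varphi_n$. -}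

module Defs where

open import Data.Nat using (ℕ; suc; _≤_)
open import Data.Fin using (Fin)
open import Data.Fin.Subset using (Subset; _∪_; _─_; _⊆_; ⁅_⁆; ⊥; ⋃; _∈_)
open import Data.Fin.Subset.Properties using (_⊆?_)
open import Data.Bool using (Bool)
import Data.Bool.Properties as BoolP
open import Data.Vec using (Vec; toList; take)
import Data.Vec.Properties as VecP
open import Data.List as List using (List; filter; map; []; _∷_)
import Data.List.Membership.Propositional as LM
import Data.List.Membership.DecPropositional as DecMem
open import Data.Product using (Σ; ∃; _×_; _,_)
open import Data.Sum using (_⊎_)
open import Relation.Binary.PropositionalEquality using (_≡_)
open import Relation.Binary.Definitions using (DecidableEquality)
open import Relation.Nullary using (yes; no)
open import Function using (id; _∘_)

-- The ground set X is Fin n; subsets of X are Subset n.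
-- A finite family of subsets is represented as a list (duplicates irrelevant).
Family : ℕ → Set
Family n = List (Subset n)

_≟S_ : ∀ {n} → DecidableEquality (Subset n)
_≟S_ = VecP.≡-dec BoolP._≟_

_∈F_ : ∀ {n} → Subset n → Family n → Set
z ∈F 𝓕 = z LM.∈ 𝓕

_∈F?_ : ∀ {n} (z : Subset n) (𝓕 : Family n) → Relation.Nullary.Dec (z ∈F 𝓕)
z ∈F? 𝓕 = DecMem._∈?_ _≟S_ z 𝓕

UnionClosed : ∀ {n} → Family n → Set
UnionClosed 𝓕 = ∀ f g → f ∈F 𝓕 → g ∈F 𝓕 → (f ∪ g) ∈F 𝓕

CoversX : ∀ {n} → Family n → Set
CoversX {n} 𝓕 = ∀ (x : Fin n) → ∃ λ f → f ∈F 𝓕 × x ∈ f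

IsMin : ∀ {n} → Family n → Subset n → Set
IsMin 𝓕 h = h ∈F 𝓕 × (∀ h′ → h′ ∈F 𝓕 → h′ ⊆ h → h′ ≡ h)

InMinUp : ∀ {n} → Family n → Subset n → Set
InMinUp 𝓕 z = ∃ λ h → IsMin 𝓕 h × h ⊆ z

star : ∀ {n} → Family n → Subset n → Subset n
star 𝓕 z = ⋃ (filter (λ h → h ⊆? z) 𝓕)

InFib : ∀ {n} → Family n → Subset n → Subset n → Set
InFib 𝓕 g z = InMinUp 𝓕 z × star 𝓕 z ≡ g

InMaxFib : ∀ {n} → Family n → Subset n → Subset n → Set
InMaxFib 𝓕 g η = InFib 𝓕 g η × (∀ z → InFib 𝓕 g z → η ⊆ z → z ≡ η)

-- A word listing the elements of X: length n, pairwise distinct letters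
-- (hence each element of X occurs exactly once).
Word : ℕ → Set
Word n = Vec (Fin n) n

ListsX : ∀ {n} → Word n → Set
ListsX {n} u = ∀ (i j : Fin n) → Data.Vec.lookup u i ≡ Data.Vec.lookup u j → i ≡ j

prefixSet : ∀ {n} → (l : ℕ) → List (Fin n) → Subset n
prefixSet l u = ⋃ (map ⁅_⁆ (List.take l u))

InPrefix : ∀ {n} → Subset n → Word n → Set
InPrefix {n} γ u = γ ≡ ⊥ ⊎ (∃ λ l → 1 ≤ l × l ≤ n × γ ≡ prefixSet l (toList u))

rise : ∀ {n} → Family n → Fin n → Subset n → Subset n
rise T a z with (z ∪ ⁅ a ⁆) ∈F? T
... | yes _ = z
... | no  _ = z ∪ ⁅ a ⁆

-- φ_u, built iteratively: φ_j = φ_{𝓕_{j-1}, b_j} ∘ φ_{j-1}, 𝓕_{j-1} = φ_{j-1}(𝓕)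
risingFrom : ∀ {n} → Family n → (Subset n → Subset n) → List (Fin n) → Subset n → Subset n
risingFrom 𝓕 φ []       = φ
risingFrom 𝓕 φ (b ∷ bs) = risingFrom 𝓕 (rise (map φ 𝓕) b ∘ φ) bs

φ[_,_] : ∀ {n} → Family n → Word n → Subset n → Subset n
φ[ 𝓕 , u ] = risingFrom 𝓕 id (toList u)

module Submission where

-- Since η* = g, P = η ∖ g.  Split u = v ++ w with v = b₁⋯b_k.
-- Phase 1 (letters of v).  After each letter, φ satisfies an invariant
-- relative to the set D of letters read so far: z ⊆ φ z ⊆ z ∪ D,
-- φ g = g ∪ D, D ⊆ η, and (η ∪ s)* ∪ D belongs to the current family for
-- every s.  The key step: g ∪ D ∪ {b} (b ∈ P ∖ D) has no preimage f in 𝓕,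
-- since it would satisfy b ∈ f ⊆ η, so f ⊆ η* = g ∌ b; hence g rises.
-- At the end D = P, so φ g = η; by maximality of η, (η ∪ s)* ∪ P = η ∪ s,
-- so every superset of η belongs to the current family.
-- Phase 2 (letters of w).  Then η is never moved again.

open import Defs
open import Data.Nat using (ℕ; _≤_)
open import Data.Fin using (Fin)
open import Data.Fin.Subset using (Subset; _─_; _∪_; _⊆_; _∈_; _∉_; ⁅_⁆; ⋃; inside; outside)
  renaming (⊥ to ∅)
open import Data.Fin.Subset.Properties using (_⊆?_; _∈?_; ⊆-antisym; ⊆-trans; ⊆-reflexive; ⊥⊆; p⊆p∪q; q⊆p∪q; x∈p∪q⁻; x∈⁅x⁆; x∈⁅y⁆⇒x≡y; ∉⊥; ∪-assoc; ∪-identityˡ; ∪-identityʳ; p─q⊆p; x∈p∧x∉q⇒x∈p─q)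
open import Data.List using (List; []; _∷_; map; filter; _++_; take; drop)
open import Data.List.Properties using (map-∘; map-id; take++drop≡id)
import Data.List.Membership.Propositional as LM
open import Data.List.Membership.Propositional.Properties using (∈-map⁺; ∈-map⁻; ∈-filter⁺; ∈-filter⁻)
open import Data.List.Relation.Unary.Any using (here; there)
open import Data.Vec using (toList; _∷_)
import Data.Vec.Base as Vec
open import Data.Product using (∃; _×_; _,_; proj₁; proj₂)
open import Data.Sum using (inj₁; inj₂)
open import Data.Empty using (⊥-elim)
open import Relation.Nullary using (¬_; yes; no)
open import Relation.Binary.PropositionalEquality
open import Function using (id; _∘_)

private
  variable
    n : ℕ
    p q r s : Subset n
    x : Fin n

∪-lub : p ⊆ r → q ⊆ r → p ∪ q ⊆ r
∪-lub {p = p} {q = q} p⊆r q⊆r m with x∈p∪q⁻ p q m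
... | inj₁ x∈p = p⊆r x∈p
... | inj₂ x∈q = q⊆r x∈q

∪-mono : p ⊆ q → r ⊆ s → p ∪ r ⊆ q ∪ s
∪-mono {q = q} {s = s} p⊆q r⊆s = ∪-lub (p⊆p∪q s ∘ p⊆q) (q⊆p∪q q s ∘ r⊆s)

⁅x⁆⊆ : x ∈ p → ⁅ x ⁆ ⊆ p
⁅x⁆⊆ {x = x} {p = p} x∈p m = subst (_∈ p) (sym (x∈⁅y⁆⇒x≡y x m)) x∈p

∪-absorbʳ : q ⊆ p → p ∪ q ≡ p
∪-absorbʳ q⊆p = ⊆-antisym (∪-lub id q⊆p) (p⊆p∪q _)

x∈p─q⇒x∉q : ∀ (p q : Subset n) → x ∈ p ─ q → x ∉ q
x∈p─q⇒x∉q {x = Fin.zero} (_ ∷ p) (outside ∷ q) Vec.here ()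
x∈p─q⇒x∉q {x = Fin.zero} (_ ∷ p) (inside ∷ q) ()
x∈p─q⇒x∉q {x = Fin.suc x} (_ ∷ p) (_ ∷ q) (Vec.there m) (Vec.there m′) = x∈p─q⇒x∉q p q m m′

∪-─-cancel : q ⊆ p → q ∪ (p ─ q) ≡ p
∪-─-cancel {q = q} {p = p} q⊆p = ⊆-antisym (∪-lub q⊆p (p─q⊆p p q)) split
  where
  split : p ⊆ q ∪ (p ─ q)
  split {x} x∈p with x ∈? q
  ... | yes x∈q = p⊆p∪q _ x∈q
  ... | no x∉q = q⊆p∪q q _ (x∈p∧x∉q⇒x∈p─q x∈p x∉q)

⋃-upper : ∀ {xs : List (Subset n)} {y} → y LM.∈ xs → y ⊆ ⋃ xs
⋃-upper {xs = y ∷ xs} (here refl) = p⊆p∪q (⋃ xs)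
⋃-upper {xs = y ∷ xs} (there m) = q⊆p∪q y (⋃ xs) ∘ ⋃-upper m

⋃-witness : ∀ (xs : List (Subset n)) → x ∈ ⋃ xs → ∃ λ y → y LM.∈ xs × x ∈ y
⋃-witness [] m = ⊥-elim (∉⊥ m)
⋃-witness (y ∷ xs) m with x∈p∪q⁻ y (⋃ xs) m
... | inj₁ x∈y = y , here refl , x∈y
... | inj₂ x∈⋃ with ⋃-witness xs x∈⋃
... | y′ , y′∈ , x∈y′ = y′ , there y′∈ , x∈y′

⋃-closed : ∀ {F : Family n} → UnionClosed F → (xs : List (Subset n)) →
           (∀ {y} → y LM.∈ xs → y ∈F F) → ∀ {z} → z LM.∈ xs → ⋃ xs ∈F F
⋃-closed {F = F} uc (y ∷ []) inF _ = subst (_∈F F) (sym (∪-identityʳ y)) (inF (here refl))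
⋃-closed uc (y ∷ y′ ∷ ys) inF _ =
  uc y (⋃ (y′ ∷ ys)) (inF (here refl)) (⋃-closed uc (y′ ∷ ys) (inF ∘ there) (here refl))

module Star {n : ℕ} (F : Family n) where

  below : Subset n → Family n
  below z = filter (λ h → h ⊆? z) F

  below⁺ : ∀ {h z} → h ∈F F → h ⊆ z → h LM.∈ below z
  below⁺ {z = z} = ∈-filter⁺ (λ h → h ⊆? z)

  below⁻ : ∀ {h z} → h LM.∈ below z → h ∈F F × h ⊆ z
  below⁻ {z = z} = ∈-filter⁻ (λ h → h ⊆? z) {xs = F}

  star-upper : ∀ {h z} → h ∈F F → h ⊆ z → h ⊆ star F z
  star-upper hF h⊆z = ⋃-upper (below⁺ hF h⊆z)

  star-least : ∀ {z w} → (∀ {h} → h ∈F F → h ⊆ z → h ⊆ w) → star F z ⊆ w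
  star-least {z} bound m with ⋃-witness (below z) m
  ... | h , h∈ , x∈h = bound (proj₁ (below⁻ h∈)) (proj₂ (below⁻ h∈)) x∈h

  star-⊆ : ∀ {z} → star F z ⊆ z
  star-⊆ = star-least (λ _ h⊆z → h⊆z)

  star-mono : ∀ {z w} → z ⊆ w → star F z ⊆ star F w
  star-mono z⊆w = star-least (λ hF h⊆z → star-upper hF (z⊆w ∘ h⊆z))

  star-∈ : UnionClosed F → ∀ {h z} → h ∈F F → h ⊆ z → star F z ∈F F
  star-∈ uc hF h⊆z = ⋃-closed uc _ (proj₁ ∘ below⁻) (below⁺ hF h⊆z)

module Rise {n : ℕ} (T : Family n) (a : Fin n) where

  rise-yes : ∀ z → (z ∪ ⁅ a ⁆) ∈F T → rise T a z ≡ z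
  rise-yes z m with (z ∪ ⁅ a ⁆) ∈F? T
  ... | yes _ = refl
  ... | no ¬m = ⊥-elim (¬m m)

  rise-no : ∀ z → ¬ ((z ∪ ⁅ a ⁆) ∈F T) → rise T a z ≡ z ∪ ⁅ a ⁆
  rise-no z ¬m with (z ∪ ⁅ a ⁆) ∈F? T
  ... | yes m = ⊥-elim (¬m m)
  ... | no _ = refl

  rise-⊇ : ∀ z → z ⊆ rise T a z
  rise-⊇ z with (z ∪ ⁅ a ⁆) ∈F? T
  ... | yes _ = id
  ... | no _ = p⊆p∪q ⁅ a ⁆

  rise-⊆ : ∀ z → rise T a z ⊆ z ∪ ⁅ a ⁆
  rise-⊆ z with (z ∪ ⁅ a ⁆) ∈F? T
  ... | yes _ = p⊆p∪q ⁅ a ⁆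
  ... | no _ = id

  rise-fix : ∀ z → a ∈ z → rise T a z ≡ z
  rise-fix z a∈z with (z ∪ ⁅ a ⁆) ∈F? T
  ... | yes _ = refl
  ... | no _ = ∪-absorbʳ (⁅x⁆⊆ a∈z)

  rise-image-∪ : ∀ z → z ∈F T → (z ∪ ⁅ a ⁆) ∈F map (rise T a) T
  rise-image-∪ z z∈T with (z ∪ ⁅ a ⁆) ∈F? T
  ... | yes z+a∈T = subst (_∈F map (rise T a) T)
                      (rise-fix (z ∪ ⁅ a ⁆) (q⊆p∪q z ⁅ a ⁆ (x∈⁅x⁆ a)))
                      (∈-map⁺ (rise T a) z+a∈T)
  ... | no z+a∉T = subst (_∈F map (rise T a) T) (rise-no z z+a∉T) (∈-map⁺ (rise T a) z∈T)

  rise-image-keep : ∀ z → z ∈F T → (z ∪ ⁅ a ⁆) ∈F T → z ∈F map (rise T a) T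
  rise-image-keep z z∈T z+a∈T =
    subst (_∈F map (rise T a) T) (rise-yes z z+a∈T) (∈-map⁺ (rise T a) z∈T)

open Rise

risingFrom-++ : ∀ (F : Family n) (φ : Subset n → Subset n) (xs ys : List (Fin n)) →
                risingFrom F φ (xs ++ ys) ≡ risingFrom F (risingFrom F φ xs) ys
risingFrom-++ F φ [] ys = refl
risingFrom-++ F φ (b ∷ xs) ys = risingFrom-++ F (rise (map φ F) b ∘ φ) xs ys

rising-stable : ∀ (F : Family n) (η x : Subset n) (φ : Subset n → Subset n) (R : List (Fin n)) →
                (∀ s → (η ∪ s) ∈F map φ F) → φ x ≡ η → risingFrom F φ R x ≡ η
rising-stable F η x φ [] _ φx≡η = φx≡η
rising-stable F η x φ (b ∷ R) upset φx≡η =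
  rising-stable F η x (rise T b ∘ φ) R upset′ (trans (cong (rise T b) φx≡η) η-fixed)
  where
  T : Family _
  T = map φ F
  η-fixed : rise T b η ≡ η
  η-fixed = rise-yes T b η (upset ⁅ b ⁆)
  upset′ : ∀ s → (η ∪ s) ∈F map (rise T b ∘ φ) F
  upset′ s = subst ((η ∪ s) ∈F_) (sym (map-∘ F))
               (rise-image-keep T b (η ∪ s) (upset s)
                 (subst (_∈F T) (sym (∪-assoc η s ⁅ b ⁆)) (upset (s ∪ ⁅ b ⁆))))

module Fibre {n : ℕ} (F : Family n) (uc : UnionClosed F)
             (g : Subset n) (g∈F : g ∈F F) (η : Subset n) (η-max : InMaxFib F g η) where

  open Star F

  star-η : star F η ≡ g
  star-η = proj₂ (proj₁ η-max)

  g⊆η : g ⊆ η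
  g⊆η = subst (_⊆ η) star-η star-⊆

  fibre-above-η : ∀ {z} → η ⊆ z → star F z ≡ g → z ≡ η
  fibre-above-η {z} η⊆z z*≡g = proj₂ η-max z (minUp , z*≡g) η⊆z
    where
    minUp : InMinUp F z
    minUp with proj₁ (proj₁ η-max)
    ... | h , h-min , h⊆η = h , h-min , η⊆z ∘ h⊆η

  new-element-in-star : ∀ a → a ∉ η → a ∈ star F (η ∪ ⁅ a ⁆)
  new-element-in-star a a∉η with a ∈? star F (η ∪ ⁅ a ⁆)
  ... | yes a∈ = a∈
  ... | no a∉ = ⊥-elim (a∉η (subst (a ∈_) η+a≡η (q⊆p∪q η ⁅ a ⁆ (x∈⁅x⁆ a))))
    where
    members-below-η : ∀ {h} → h ∈F F → h ⊆ η ∪ ⁅ a ⁆ → h ⊆ star F η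
    members-below-η {h} hF h⊆ = star-upper hF h⊆η
      where
      h⊆η : h ⊆ η
      h⊆η x∈h with x∈p∪q⁻ η ⁅ a ⁆ (h⊆ x∈h)
      ... | inj₁ x∈η = x∈η
      ... | inj₂ x≡a = ⊥-elim (a∉ (star-upper hF h⊆ (subst (_∈ h) (x∈⁅y⁆⇒x≡y a x≡a) x∈h)))
    η+a≡η : η ∪ ⁅ a ⁆ ≡ η
    η+a≡η = fibre-above-η (p⊆p∪q ⁅ a ⁆)
              (trans (⊆-antisym (star-least members-below-η) (star-mono (p⊆p∪q ⁅ a ⁆))) star-η)

  star-∪-saturates : ∀ {D} → g ∪ D ≡ η → ∀ s → star F (η ∪ s) ∪ D ≡ η ∪ s
  star-∪-saturates {D} g∪D≡η s = ⊆-antisym (∪-lub star-⊆ (p⊆p∪q s ∘ D⊆η)) (∪-lub η⊆ s⊆)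
    where
    D⊆η : D ⊆ η
    D⊆η = subst (D ⊆_) g∪D≡η (q⊆p∪q g D)
    η⊆ : η ⊆ star F (η ∪ s) ∪ D
    η⊆ = subst (_⊆ star F (η ∪ s) ∪ D) g∪D≡η
           (∪-mono (star-upper g∈F (p⊆p∪q s ∘ g⊆η)) id)
    s⊆ : s ⊆ star F (η ∪ s) ∪ D
    s⊆ {x} x∈s with x ∈? η
    ... | yes x∈η = η⊆ x∈η
    ... | no x∉η = p⊆p∪q D (star-mono (∪-mono id (⁅x⁆⊆ x∈s)) (new-element-in-star x x∉η))

  record Invariant (φ : Subset n → Subset n) (D : Subset n) : Set where
    field
      extensive : ∀ z → z ⊆ φ z
      bounded   : ∀ z → φ z ⊆ z ∪ D
      D⊆η       : D ⊆ η
      image-g   : φ g ≡ g ∪ D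
      stars     : ∀ s → (star F (η ∪ s) ∪ D) ∈F map φ F

  initial : Invariant id ∅
  initial = record
    { extensive = λ _ → id
    ; bounded   = λ z → p⊆p∪q ∅
    ; D⊆η       = ⊥⊆
    ; image-g   = sym (∪-identityʳ g)
    ; stars     = λ s → subst₂ _∈F_ (sym (∪-identityʳ _)) (sym (map-id F))
                          (star-∈ uc g∈F (p⊆p∪q s ∘ g⊆η))
    }

  -- The key step: for b ∈ η ∖ g outside D, g ∪ D ∪ {b} is not in the
  -- current family, since a preimage f would give b ∈ f ⊆ η, so b ∈ η* = g.
  fresh-not-in-family : ∀ {φ D b} → Invariant φ D → b ∈ η → b ∉ g → b ∉ D →
                        ¬ (((g ∪ D) ∪ ⁅ b ⁆) ∈F map φ F)
  fresh-not-in-family {φ} {D} {b} inv b∈η b∉g b∉D m with ∈-map⁻ φ m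
  ... | f , f∈F , eq
    with x∈p∪q⁻ f D (Invariant.bounded inv f (subst (b ∈_) eq (q⊆p∪q _ ⁅ b ⁆ (x∈⁅x⁆ b))))
  ... | inj₂ b∈D = b∉D b∈D
  ... | inj₁ b∈f = b∉g (subst (b ∈_) star-η (star-upper f∈F f⊆η b∈f))
    where
    f⊆η : f ⊆ η
    f⊆η = ⊆-trans (Invariant.extensive inv f)
            (subst (_⊆ η) eq (∪-lub (∪-lub g⊆η (Invariant.D⊆η inv)) (⁅x⁆⊆ b∈η)))

  step : ∀ {φ D b} → Invariant φ D → b ∈ η ─ g →
         Invariant (rise (map φ F) b ∘ φ) (D ∪ ⁅ b ⁆)
  step {φ} {D} {b} inv b∈η─g = record
    { extensive = λ z → ⊆-trans (extensive z) (rise-⊇ T b (φ z))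
    ; bounded   = λ z → ⊆-trans (rise-⊆ T b (φ z))
                          (⊆-trans (∪-mono (bounded z) id) (⊆-reflexive (∪-assoc z D ⁅ b ⁆)))
    ; D⊆η       = ∪-lub D⊆η (⁅x⁆⊆ b∈η)
    ; image-g   = trans (cong (rise T b) image-g) g-rises
    ; stars     = λ s → subst ((star F (η ∪ s) ∪ (D ∪ ⁅ b ⁆)) ∈F_) (sym (map-∘ F))
                          (subst (_∈F map (rise T b) T) (∪-assoc (star F (η ∪ s)) D ⁅ b ⁆)
                            (rise-image-∪ T b _ (stars s)))
    }
    where
    open Invariant inv
    T : Family n
    T = map φ F
    b∈η : b ∈ η
    b∈η = p─q⊆p η g b∈η─g
    g-rises : rise T b (g ∪ D) ≡ g ∪ (D ∪ ⁅ b ⁆)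
    g-rises with b ∈? D
    ... | yes b∈D = trans (rise-fix T b (g ∪ D) (q⊆p∪q g D b∈D))
                          (cong (g ∪_) (sym (∪-absorbʳ (⁅x⁆⊆ b∈D))))
    ... | no b∉D = trans (rise-no T b (g ∪ D)
                           (fresh-not-in-family inv b∈η (x∈p─q⇒x∉q η g b∈η─g) b∉D))
                         (∪-assoc g D ⁅ b ⁆)

  read-letters : ∀ {φ D} (R : List (Fin n)) → Invariant φ D → ⋃ (map ⁅_⁆ R) ⊆ η ─ g →
                 Invariant (risingFrom F φ R) (D ∪ ⋃ (map ⁅_⁆ R))
  read-letters {φ} {D} [] inv _ = subst (Invariant φ) (sym (∪-identityʳ D)) inv
  read-letters {φ} {D} (b ∷ R) inv R⊆ =
    subst (Invariant (risingFrom F φ (b ∷ R))) (∪-assoc D ⁅ b ⁆ _)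
      (read-letters R (step inv (R⊆ (p⊆p∪q _ (x∈⁅x⁆ b)))) (R⊆ ∘ q⊆p∪q ⁅ b ⁆ _))

  after-enumeration : ∀ (R : List (Fin n)) → ⋃ (map ⁅_⁆ R) ≡ η ─ g →
                      Invariant (risingFrom F id R) (η ─ g)
  after-enumeration R R≡P = subst (Invariant (risingFrom F id R)) (trans (∪-identityˡ _) R≡P)
    (read-letters R initial (⊆-reflexive R≡P))

  phase-1-complete : ∀ {φ} → Invariant φ (η ─ g) →
                     φ g ≡ η × (∀ s → (η ∪ s) ∈F map φ F)
  phase-1-complete {φ} inv =
    trans image-g g∪P≡η , λ s → subst (_∈F map φ F) (star-∪-saturates g∪P≡η s) (stars s)
    where
    open Invariant inv
    g∪P≡η : g ∪ (η ─ g) ≡ η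
    g∪P≡η = ∪-─-cancel g⊆η

lemma4p2 : (n : ℕ) → 1 ≤ n → (𝓕 : Family n) → UnionClosed 𝓕 → CoversX 𝓕 →
    (g : Subset n) → g ∈F 𝓕 → (η : Subset n) → InMaxFib 𝓕 g η →
    (u : Word n) → ListsX u → InPrefix (η ─ star 𝓕 η) u →
    φ[ 𝓕 , u ] g ≡ η
lemma4p2 n _ F uc _ g g∈F η η-max u _ prefix = proof (prefix-length prefix)
  where
  open Fibre F uc g g∈F η η-max
  L : List (Fin n)
  L = toList u
  prefix-length : InPrefix (η ─ star F η) u → ∃ λ k → η ─ star F η ≡ prefixSet k L
  prefix-length (inj₁ P≡∅) = 0 , P≡∅
  prefix-length (inj₂ (k , _ , _ , P≡)) = k , P≡
  proof : (∃ λ k → η ─ star F η ≡ prefixSet k L) → φ[ F , u ] g ≡ η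
  proof (k , P≡) = begin
    risingFrom F id L g
      ≡⟨ cong (λ w → risingFrom F id w g) (sym (take++drop≡id k L)) ⟩
    risingFrom F id (take k L ++ drop k L) g
      ≡⟨ cong-app (risingFrom-++ F id (take k L) (drop k L)) g ⟩
    risingFrom F (risingFrom F id (take k L)) (drop k L) g
      ≡⟨ rising-stable F η g _ (drop k L) (proj₂ done) (proj₁ done) ⟩
    η ∎
    where
    open ≡-Reasoning
    done : risingFrom F id (take k L) g ≡ η ×
           (∀ s → (η ∪ s) ∈F map (risingFrom F id (take k L)) F)
    done = phase-1-complete (after-enumeration (take k L)
             (sym (trans (cong (η ─_) (sym star-η)) P≡)))
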